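{- Let $q$ be a prime power, $d\geq 3$, $n\geq1$, $s$ with $\gcd(s,n)=1$, $\sigma\colon x\mapsto x^{q^s}$ on $\mathbb{F}_{q^n}$, and $a,b\in\mathbb{F}_{q^n}$. Let $C$ be the $d\times d$ matrix with $1$ in positions $(i+1,i)$ for $i=1,\ldots,d-1$, last column $(a,b,0,\ldots,0)^T$, and zeros elsewhere. For $k\geq1$ let $A_k=CC^{\sigma}\cdots C^{\sigma^{k-1}}$ (where $C^{\sigma^i}$ is obtained by applying $\sigma^i$ entrywise) and let $M_{l,k}$ be the $(l,d)$-entry of $A_k$ for $l\in\{1,\ldots,d\}$. For $k\leq 0$ set $M_{l,l-d}=1$ and $M_{l,k}=0$ if $k\neq l-d$. Then: \begin{itemize} \item for every $k\geq d$ and $j\in\{1,\ldots,d\}$, the $(l,j)$-entry of $A_k$ is $M_{l,k-d+j}$; \item for every $1\leq l\leq d$ and $k\geq 1$, $M_{l,k}=M_{l,k-d}\,a^{\sigma^{k-1}}+M_{l,k-d+1}\,b^{\sigma^{k-1}}$. \end{itemize}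
   Context: $a^{\sigma^i}$ denotes $\sigma^i(a)$. -}

module Defs where

open import Level using (Level; _⊔_)
open import Algebra.Bundles using (CommutativeRing; Semiring)
open import Data.Nat using (ℕ; zero; suc; _≟_; _≤_; _^_; _∸_)
open import Data.Nat.Primality using (Prime)
open import Data.Fin using (Fin; toℕ; fromℕ)
open import Data.Integer as ℤ using (ℤ; +_; +[1+_])
open import Data.Product using (Σ; ∃; _×_)
open import Data.Empty using (⊥)
open import Relation.Nullary using (¬_; yes; no)
open import Relation.Binary.PropositionalEquality as ≡ using (_≡_)
open import Function.Bundles using (Bijection)

IsPrimePower : ℕ → Set
IsPrimePower q = Σ ℕ λ p → Σ ℕ λ e → Prime p × (1 ≤ e) × (q ≡ p ^ e)

iter : ∀ {a} {A : Set a} → (A → A) → ℕ → A → A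
iter f zero    x = x
iter f (suc i) x = f (iter f i x)

module _ {c ℓ : Level} (R : CommutativeRing c ℓ) where
  open CommutativeRing R
  open import Algebra.Definitions.RawMonoid +-rawMonoid using (sum)
  open import Algebra.Definitions.RawSemiring (Semiring.rawSemiring semiring) using () renaming (_^_ to _^ᴿ_)

  record IsField : Set (c ⊔ ℓ) where
    field
      0≉1     : ¬ (0# ≈ 1#)
      inverse : ∀ x → ¬ (x ≈ 0#) → Σ Carrier λ y → x * y ≈ 1#

  HasOrder : ℕ → Set (c ⊔ ℓ)
  HasOrder m = Bijection setoid (≡.setoid (Fin m))

  IsFiniteFieldOfOrder : ℕ → Set (c ⊔ ℓ)
  IsFiniteFieldOfOrder m = IsField × HasOrder m

  frob : ℕ → ℕ → Carrier → Carrier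
  frob q s x = x ^ᴿ (q ^ s)

  -- d × d matrices over R, 0-indexed (entry (i,j) here is entry (i+1,j+1) of the paper)
  Matrix : ℕ → Set c
  Matrix d = Fin d → Fin d → Carrier

  _⊗_ : ∀ {d} → Matrix d → Matrix d → Matrix d
  (X ⊗ Y) i j = sum (λ k → X i k * Y k j)

  identity : ∀ {d} → Matrix d
  identity i j with toℕ i ≟ toℕ j
  ... | yes _ = 1#
  ... | no  _ = 0#

  mapM : ∀ {d} → (Carrier → Carrier) → Matrix d → Matrix d
  mapM f X i j = f (X i j)

  companion : (d : ℕ) → Carrier → Carrier → Matrix d
  companion d a b i j with toℕ j ≟ d ∸ 1
  ... | yes _ with toℕ i
  ...   | zero        = a
  ...   | suc zero    = b
  ...   | suc (suc _) = 0#
  companion d a b i j | no _ with toℕ i ≟ suc (toℕ j)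
  ...   | yes _ = 1#
  ...   | no  _ = 0#

  -- A_k = C C^σ ⋯ C^{σ^{k-1}}  (A_0 = identity, only used for k ≥ 1)
  Aₖ : (d : ℕ) → (σ : Carrier → Carrier) → Carrier → Carrier → ℕ → Matrix d
  Aₖ d σ a b zero    = identity
  Aₖ d σ a b (suc k) = Aₖ d σ a b k ⊗ mapM (iter σ k) (companion d a b)

  -- M_{l,k} for k ∈ ℤ, l ∈ Fin d (paper index l = toℕ l + 1):
  -- for k ≥ 1, the (l,d)-entry of A_k; for k ≤ 0, 1 if k = l - d and 0 otherwise.
  Mₗₖ : (d : ℕ) → (σ : Carrier → Carrier) → Carrier → Carrier → Fin d → ℤ → Carrier
  Mₗₖ (suc d') σ a b l +[1+ m ] = Aₖ (suc d') σ a b (suc m) l (fromℕ d')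
  Mₗₖ d σ a b l k with k ℤ.≟ ((+ (suc (toℕ l))) ℤ.- (+ d))
  ... | yes _ = 1#
  ... | no  _ = 0#

-- The matrix A_{k+1} = A_k C^{σ^k} is obtained from A_k by shifting every column one place to the
-- left and appending the column A_k e_1 a^{σ^k} + A_k e_2 b^{σ^k}, since column j < d of C is the
-- unit vector e_{j+1} and its last column is (a, b, 0, …, 0)ᵀ.  Hence the columns of A_k are
-- consecutive values of the last-column sequence M_{l,·}, by induction on k from A_0 = I, which is
-- exactly how the initial values M_{l,k} (k ≤ 0) are chosen; reading off the last column of
-- A_{k+1} gives the recurrence.
module Submission where

open import Defs
open import Algebra.Bundles using (CommutativeRing)
open import Data.Nat using (ℕ; suc; _≤_; _^_)
open import Data.Nat.GCD using (gcd)
open import Data.Fin using (toℕ)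
open import Data.Integer using (+_; +[1+_]) renaming (_+_ to _+ℤ_; _-_ to _-ℤ_)
open import Data.Product using (_×_)
open import Relation.Binary.PropositionalEquality using (_≡_)

open import Data.Bool using (if_then_else_)
open import Data.Empty using (⊥-elim)
open import Data.Fin using (Fin; zero; suc; fromℕ; inject₁; punchIn)
import Data.Fin.Properties as Fin
open import Data.Integer as ℤ using (ℤ; +0; -[1+_])
import Data.Integer.Properties as ℤ
open import Algebra.Properties.AbelianGroup ℤ.+-0-abelianGroup using () renaming (∙-cancelʳ to +-cancelʳ)
open import Data.Integer.Tactic.RingSolver using (solve-∀)
open import Data.Nat as ℕ using (zero; s≤s; NonZero)
import Data.Nat.Properties as ℕ
open import Data.Nat.Primality using (prime⇒nonZero)
open import Data.Product using (_,_)
open import Relation.Binary.Core using (_Preserves_⟶_)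
open import Relation.Binary.PropositionalEquality as ≡ using (_≢_; cong; subst)
open import Relation.Nullary using (does; yes; no)
open import Relation.Nullary.Decidable using (dec-true; dec-false)

data LastOrInject₁ {n : ℕ} : Fin (suc n) → Set where
  last   : LastOrInject₁ (fromℕ n)
  inject : (i : Fin n) → LastOrInject₁ (inject₁ i)

lastOrInject₁ : ∀ {n} (j : Fin (suc n)) → LastOrInject₁ j
lastOrInject₁ {zero}  zero    = last
lastOrInject₁ {suc n} zero    = inject zero
lastOrInject₁ {suc n} (suc j) with lastOrInject₁ j
... | last     = last
... | inject i = inject (suc i)

prime-power-nonZero : ∀ {q} → IsPrimePower q → NonZero q
prime-power-nonZero (p , e , p-prime , _ , ≡.refl) = ℕ.m^n≢0 p e {{prime⇒nonZero p-prime}}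

-- The paper's index k - d + j of column j, with j 1-based there and 0-based here.
offset : (d : ℕ) → ℕ → Fin d → ℤ
offset d k j = (+ k -ℤ + d) +ℤ + suc (toℕ j)

offset-zero : ∀ d (j : Fin d) → offset d 0 j ≡ + suc (toℕ j) -ℤ + d
offset-zero d j = lemma (+ suc (toℕ j)) (+ d)
  where
  lemma : ∀ J D → (+ 0 -ℤ D) +ℤ J ≡ J -ℤ D
  lemma = solve-∀

offset-zero-nonpositive : ∀ d (j : Fin d) → offset d 0 j ℤ.≤ +0
offset-zero-nonpositive d j = subst (ℤ._≤ +0) (≡.sym (offset-zero d j)) (ℤ.i≤j⇒i-j≤0 (ℤ.+≤+ (Fin.toℕ<n j)))

offset-suc : ∀ d k (i : Fin d) → offset (suc d) k (suc i) ≡ offset (suc d) (suc k) (inject₁ i)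
offset-suc d k i = ≡.trans (lemma (+ k) (+ suc d) (+ toℕ i))
                           (cong (λ x → (+ suc k -ℤ + suc d) +ℤ + suc x) (≡.sym (Fin.toℕ-inject₁ i)))
  where
  lemma : ∀ K D I → (K -ℤ D) +ℤ (+ 1 +ℤ (+ 1 +ℤ I)) ≡ ((+ 1 +ℤ K) -ℤ D) +ℤ (+ 1 +ℤ I)
  lemma = solve-∀

offset-last : ∀ n k → offset (suc n) (suc k) (fromℕ n) ≡ +[1+ k ]
offset-last n k = ≡.trans (cong (λ x → (+ suc k -ℤ + suc n) +ℤ + suc x) (Fin.toℕ-fromℕ n))
                          (lemma (+ suc k) (+ suc n))
  where
  lemma : ∀ K D → (K -ℤ D) +ℤ D ≡ K
  lemma = solve-∀

offset-first : ∀ d m → offset (suc d) m zero ≡ +[1+ m ] -ℤ + suc d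
offset-first d m = lemma (+ m) (+ suc d)
  where
  lemma : ∀ K D → (K -ℤ D) +ℤ + 1 ≡ (+ 1 +ℤ K) -ℤ D
  lemma = solve-∀

offset-second : ∀ d m → offset (suc (suc d)) m (suc zero) ≡ (+[1+ m ] -ℤ + suc (suc d)) +ℤ + 1
offset-second d m = lemma (+ m) (+ suc (suc d))
  where
  lemma : ∀ K D → (K -ℤ D) +ℤ (+ 1 +ℤ + 1) ≡ ((+ 1 +ℤ K) -ℤ D) +ℤ + 1
  lemma = solve-∀

module _ {c ℓ} (R : CommutativeRing c ℓ) where
  open CommutativeRing R hiding (zero)
  open import Algebra.Properties.Monoid.Sum +-monoid using (sum; sum-cong-≋; sum-replicate-zero)
  open import Algebra.Properties.CommutativeMonoid.Sum +-commutativeMonoid using (sum-remove)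
  open import Relation.Binary.Reasoning.Setoid setoid

  sum-zero : ∀ {n} (t : Fin n → Carrier) → (∀ i → t i ≈ 0#) → sum t ≈ 0#
  sum-zero {n} t t≈0 = trans (sum-cong-≋ t≈0) (sum-replicate-zero n)

  sum-single : ∀ {n} (t : Fin (suc n) → Carrier) i → (∀ k → k ≢ i → t k ≈ 0#) → sum t ≈ t i
  sum-single t i t≈0 = begin
    sum t                             ≈⟨ sum-remove t ⟩
    t i + sum (λ k → t (punchIn i k)) ≈⟨ +-congˡ (sum-zero _ (λ k → t≈0 (punchIn i k) (Fin.punchInᵢ≢i i k))) ⟩
    t i + 0#                          ≈⟨ +-identityʳ _ ⟩
    t i                               ∎

  identity-diagonal : ∀ {d} (i : Fin d) → identity R i i ≡ 1#
  identity-diagonal i with toℕ i ℕ.≟ toℕ i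
  ... | yes _   = ≡.refl
  ... | no i≢i = ⊥-elim (i≢i ≡.refl)

  identity-off-diagonal : ∀ {d} {i j : Fin d} → i ≢ j → identity R i j ≡ 0#
  identity-off-diagonal {i = i} {j} i≢j with toℕ i ℕ.≟ toℕ j
  ... | yes i≡j = ⊥-elim (i≢j (Fin.toℕ-injective i≡j))
  ... | no _    = ≡.refl

  ⊗-identityʳ : ∀ {d} (X : Matrix R d) l j → _⊗_ R X (identity R) l j ≈ X l j
  ⊗-identityʳ {suc d} X l j = begin
    sum (λ t → X l t * identity R t j) ≈⟨ sum-single (λ t → X l t * identity R t j) j off-diagonal≈0 ⟩
    X l j * identity R j j             ≈⟨ *-congˡ (reflexive (identity-diagonal j)) ⟩
    X l j * 1#                         ≈⟨ *-identityʳ _ ⟩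
    X l j                              ∎
    where
    off-diagonal≈0 : ∀ t → t ≢ j → X l t * identity R t j ≈ 0#
    off-diagonal≈0 t t≢j = trans (*-congˡ (reflexive (identity-off-diagonal t≢j))) (zeroʳ _)

  ⊗-column-cong : ∀ {d} (X Y Y′ : Matrix R d) (j j′ : Fin d) → (∀ t → Y t j ≈ Y′ t j′) →
                  ∀ l → _⊗_ R X Y l j ≈ _⊗_ R X Y′ l j′
  ⊗-column-cong X Y Y′ j j′ Y≈Y′ l = sum-cong-≋ (λ t → *-congˡ (Y≈Y′ t))

  companion-subdiagonal : ∀ {n} a b {t j : Fin (suc n)} → n ≢ toℕ j → toℕ t ≡ suc (toℕ j) →
                          companion R (suc n) a b t j ≡ 1#
  companion-subdiagonal {n} a b {t} {j} n≢j t≡1+j with toℕ j ℕ.≟ n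
  ... | yes j≡n = ⊥-elim (n≢j (≡.sym j≡n))
  ... | no _ with toℕ t ℕ.≟ suc (toℕ j)
  ...   | yes _     = ≡.refl
  ...   | no t≢1+j = ⊥-elim (t≢1+j t≡1+j)

  companion-off-subdiagonal : ∀ {n} a b {t j : Fin (suc n)} → n ≢ toℕ j → toℕ t ≢ suc (toℕ j) →
                              companion R (suc n) a b t j ≡ 0#
  companion-off-subdiagonal {n} a b {t} {j} n≢j t≢1+j with toℕ j ℕ.≟ n
  ... | yes j≡n = ⊥-elim (n≢j (≡.sym j≡n))
  ... | no _ with toℕ t ℕ.≟ suc (toℕ j)
  ...   | yes t≡1+j = ⊥-elim (t≢1+j t≡1+j)
  ...   | no _      = ≡.refl

  companion-inject₁ : ∀ {n} a b (t : Fin (suc n)) (i : Fin n) →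
                      companion R (suc n) a b t (inject₁ i) ≡ identity R t (suc i)
  companion-inject₁ a b t i with t Fin.≟ suc i
  ... | yes ≡.refl = ≡.trans (companion-subdiagonal a b (Fin.toℕ-inject₁-≢ i) (cong suc (≡.sym (Fin.toℕ-inject₁ i))))
                             (≡.sym (identity-diagonal (suc i)))
  ... | no t≢1+i   = ≡.trans (companion-off-subdiagonal a b (Fin.toℕ-inject₁-≢ i) t≢1+i′)
                             (≡.sym (identity-off-diagonal t≢1+i))
    where
    t≢1+i′ : toℕ t ≢ suc (toℕ (inject₁ i))
    t≢1+i′ t≡1+i = t≢1+i (Fin.toℕ-injective (≡.trans t≡1+i (cong suc (Fin.toℕ-inject₁ i))))

  lastColumn : Carrier → Carrier → ℕ → Carrier
  lastColumn a b zero          = a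
  lastColumn a b (suc zero)    = b
  lastColumn a b (suc (suc _)) = 0#

  companion-last : ∀ n a b (t : Fin (suc n)) → companion R (suc n) a b t (fromℕ n) ≡ lastColumn a b (toℕ t)
  companion-last n a b t with toℕ (fromℕ n) ℕ.≟ n
  ... | no n≢n = ⊥-elim (n≢n (Fin.toℕ-fromℕ n))
  ... | yes _ with toℕ t
  ...   | zero          = ≡.refl
  ...   | suc zero      = ≡.refl
  ...   | suc (suc _)   = ≡.refl

  ⊗-companion-inject₁ : ∀ {n} (X : Matrix R (suc n)) a b l (i : Fin n) →
                        _⊗_ R X (companion R (suc n) a b) l (inject₁ i) ≈ X l (suc i)
  ⊗-companion-inject₁ {n} X a b l i =
    trans (⊗-column-cong X (companion R (suc n) a b) (identity R) (inject₁ i) (suc i)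
                         (λ t → reflexive (companion-inject₁ a b t i)) l)
          (⊗-identityʳ X l (suc i))

  ⊗-companion-last : ∀ {n} (X : Matrix R (suc (suc n))) a b l →
                     _⊗_ R X (companion R (suc (suc n)) a b) l (fromℕ (suc n)) ≈ X l zero * a + X l (suc zero) * b
  ⊗-companion-last {n} X a b l = begin
    X l zero * C zero + (X l (suc zero) * C (suc zero) + sum (λ t → X l (suc (suc t)) * C (suc (suc t))))
      ≈⟨ +-cong (*-congˡ (reflexive (companion-last (suc n) a b zero)))
                (+-cong (*-congˡ (reflexive (companion-last (suc n) a b (suc zero)))) (sum-zero _ rest≈0)) ⟩
    X l zero * a + (X l (suc zero) * b + 0#)
      ≈⟨ +-congˡ (+-identityʳ _) ⟩
    X l zero * a + X l (suc zero) * b ∎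
    where
    C : Fin (suc (suc n)) → Carrier
    C t = companion R (suc (suc n)) a b t (fromℕ (suc n))
    rest≈0 : ∀ t → X l (suc (suc t)) * C (suc (suc t)) ≈ 0#
    rest≈0 t = trans (*-congˡ (reflexive (companion-last (suc n) a b (suc (suc t))))) (zeroʳ _)

  companion-map : ∀ n (f : Carrier → Carrier) → f 0# ≈ 0# → f 1# ≈ 1# →
                  ∀ a b i j → mapM R f (companion R n a b) i j ≈ companion R n (f a) (f b) i j
  companion-map n f f0≈0 f1≈1 a b i j with toℕ j ℕ.≟ n ℕ.∸ 1
  ... | yes _ with toℕ i
  ...   | zero        = refl
  ...   | suc zero    = refl
  ...   | suc (suc _) = f0≈0
  companion-map n f f0≈0 f1≈1 a b i j | no _ with toℕ i ℕ.≟ suc (toℕ j)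
  ...   | yes _ = f1≈1
  ...   | no _  = f0≈0

  iter-fixed : ∀ {f : Carrier → Carrier} → f Preserves _≈_ ⟶ _≈_ → ∀ {x} → f x ≈ x → ∀ k → iter f k x ≈ x
  iter-fixed f-cong fx≈x zero    = refl
  iter-fixed f-cong fx≈x (suc k) = trans (f-cong (iter-fixed f-cong fx≈x k)) fx≈x

  module CompanionProduct (σ : Carrier → Carrier) (σ-cong : σ Preserves _≈_ ⟶ _≈_) (σ0≈0 : σ 0# ≈ 0#) (σ1≈1 : σ 1# ≈ 1#)
           (a b : Carrier) where

    A-suc : ∀ n k l j → Aₖ R n σ a b (suc k) l j
                        ≈ _⊗_ R (Aₖ R n σ a b k) (companion R n (iter σ k a) (iter σ k b)) l j
    A-suc n k l j = ⊗-column-cong (Aₖ R n σ a b k) (mapM R (iter σ k) (companion R n a b))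
                                  (companion R n (iter σ k a) (iter σ k b)) j j
      (λ t → companion-map n (iter σ k) (iter-fixed σ-cong σ0≈0 k) (iter-fixed σ-cong σ1≈1 k) a b t j) l

    M-nonpositive : ∀ {n} (l : Fin (suc n)) {z} → z ℤ.≤ +0 →
                    Mₗₖ R (suc n) σ a b l z ≡ (if does (z ℤ.≟ + suc (toℕ l) -ℤ + suc n) then 1# else 0#)
    M-nonpositive {n} l {+0} _ with +0 ℤ.≟ + suc (toℕ l) -ℤ + suc n
    ... | yes _ = ≡.refl
    ... | no _  = ≡.refl
    M-nonpositive l {+[1+ m ]} (ℤ.+≤+ ())
    M-nonpositive {n} l { -[1+ m ]} _ with -[1+ m ] ℤ.≟ + suc (toℕ l) -ℤ + suc n
    ... | yes _ = ≡.refl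
    ... | no _  = ≡.refl

    M-initial : ∀ {n} (l j : Fin (suc n)) → Mₗₖ R (suc n) σ a b l (offset (suc n) 0 j) ≈ identity R l j
    M-initial {n} l j with toℕ l ℕ.≟ toℕ j
    ... | yes l≡j = reflexive (≡.trans (M-nonpositive l (offset-zero-nonpositive _ j))
                     (cong (λ δ → if δ then 1# else 0#) (dec-true (_ ℤ.≟ _) offset≡)))
      where
      offset≡ : offset (suc n) 0 j ≡ + suc (toℕ l) -ℤ + suc n
      offset≡ = ≡.trans (offset-zero _ j) (cong (λ x → + suc x -ℤ + suc n) (≡.sym l≡j))
    ... | no l≢j  = reflexive (≡.trans (M-nonpositive l (offset-zero-nonpositive _ j))
                     (cong (λ δ → if δ then 1# else 0#) (dec-false (_ ℤ.≟ _) offset≢)))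
      where
      offset≢ : offset (suc n) 0 j ≢ + suc (toℕ l) -ℤ + suc n
      offset≢ eq = l≢j (≡.sym (ℕ.suc-injective (ℤ.+-injective
                     (+-cancelʳ (ℤ.- + suc n) _ _ (≡.trans (≡.sym (offset-zero _ j)) eq)))))

    A-columns : ∀ {n} k (l j : Fin (suc n)) →
                Aₖ R (suc n) σ a b k l j ≈ Mₗₖ R (suc n) σ a b l (offset (suc n) k j)
    A-columns zero    l j = sym (M-initial l j)
    A-columns {n} (suc k) l j with lastOrInject₁ j
    ... | last     = reflexive (cong (Mₗₖ R (suc n) σ a b l) (≡.sym (offset-last n k)))
    ... | inject i = begin
      A (suc k) l (inject₁ i)                         ≈⟨ A-suc (suc n) k l (inject₁ i) ⟩
      _⊗_ R (A k) (Cσ k) l (inject₁ i)                ≈⟨ ⊗-companion-inject₁ (A k) _ _ l i ⟩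
      A k l (suc i)                                   ≈⟨ A-columns k l (suc i) ⟩
      Mₗₖ R (suc n) σ a b l (offset (suc n) k (suc i)) ≡⟨ cong (Mₗₖ R (suc n) σ a b l) (offset-suc n k i) ⟩
      Mₗₖ R (suc n) σ a b l (offset (suc n) (suc k) (inject₁ i)) ∎
      where
      A : ℕ → Matrix R (suc n)
      A = Aₖ R (suc n) σ a b
      Cσ : ℕ → Matrix R (suc n)
      Cσ k = companion R (suc n) (iter σ k a) (iter σ k b)

    M-recurrence : ∀ {n} (l : Fin (suc (suc n))) m →
                   let d = suc (suc n); M = Mₗₖ R d σ a b l in
                   M +[1+ m ] ≈ M (+[1+ m ] -ℤ + d) * iter σ m a + M ((+[1+ m ] -ℤ + d) +ℤ + 1) * iter σ m b
    M-recurrence {n} l m = begin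
      A (suc m) l (fromℕ (suc n))
        ≈⟨ A-suc d m l (fromℕ (suc n)) ⟩
      _⊗_ R (A m) (companion R d σᵐa σᵐb) l (fromℕ (suc n))
        ≈⟨ ⊗-companion-last (A m) σᵐa σᵐb l ⟩
      A m l zero * σᵐa + A m l (suc zero) * σᵐb
        ≈⟨ +-cong (*-congʳ (A-columns m l zero)) (*-congʳ (A-columns m l (suc zero))) ⟩
      M (offset d m zero) * σᵐa + M (offset d m (suc zero)) * σᵐb
        ≡⟨ ≡.cong₂ (λ x y → M x * σᵐa + M y * σᵐb) (offset-first (suc n) m) (offset-second n m) ⟩
      M (+[1+ m ] -ℤ + d) * σᵐa + M ((+[1+ m ] -ℤ + d) +ℤ + 1) * σᵐb ∎
      where
      d : ℕ
      d = suc (suc n)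
      A : ℕ → Matrix R d
      A = Aₖ R d σ a b
      M : ℤ → Carrier
      M = Mₗₖ R d σ a b l
      σᵐa σᵐb : Carrier
      σᵐa = iter σ m a
      σᵐb = iter σ m b

proposition3p1 : ∀ {c ℓ} (R : CommutativeRing c ℓ) (q n s d : ℕ) →
  IsPrimePower q → 3 ≤ d → 1 ≤ n → gcd s n ≡ 1 →
  IsFiniteFieldOfOrder R (q ^ n) →
  (a b : CommutativeRing.Carrier R) →
  let open CommutativeRing R
      σ = frob R q s
      A = Aₖ R d σ a b
      M = Mₗₖ R d σ a b
  in (∀ k → d ≤ k → ∀ l j → A k l j ≈ M l ((+ k -ℤ + d) +ℤ + suc (toℕ j)))
     × (∀ l m → M l +[1+ m ] ≈ (M l (+[1+ m ] -ℤ + d) * iter σ m a)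
                                + (M l ((+[1+ m ] -ℤ + d) +ℤ + 1) * iter σ m b))
proposition3p1 R q n s .(suc (suc (suc e))) q-prime-power (s≤s (s≤s (s≤s {n = e} _))) _ _ _ a b =
  (λ k _ → A-columns k) , M-recurrence
  where
  open CommutativeRing R
  open import Algebra.Properties.Semiring.Exp semiring using (^-congˡ)
  open import Algebra.Properties.Monoid.Mult *-monoid using (×-idem)
  instance
    qˢ≢0 : NonZero (q ^ s)
    qˢ≢0 = ℕ.m^n≢0 q s {{prime-power-nonZero q-prime-power}}
  open CompanionProduct R (frob R q s) (^-congˡ (q ^ s))
                         (×-idem (zeroˡ 0#) (q ^ s)) (×-idem (*-identityˡ 1#) (q ^ s)) a b
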